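{- Let $\bm\lambda=(R_1,\dots,R_n)$ be a horizontal-strip with $l(R_i)=r(R_{i-1})+1$ for some $2\le i\le n$. Let $I=\{1,\dots,n\}\setminus\{i-1,i\}$ and define $A=\{t\in I: M_{i-1,t}=M_{i,t}=0\}$, $B=\{t\in I: R_{i-1}\prec R_t,\ R_i\prec R_t\}$, $C_{i-1}=\{t\in I: R_t\prec R_{i-1},\ M_{i,t}=0,\ M_{a,t}=0\ \forall a\in A,\ R_t\prec R_b\ \forall b\in B\}$, $C_i=\{t\in I: R_t\prec R_i,\ M_{i-1,t}=0,\ M_{a,t}=0\ \forall a\in A,\ R_t\prec R_b\ \forall b\in B\}$, and $C=C_{i-1}\cup C_i\cup\{i-1,i\}$. Suppose that for every $t\in I$: (1) if $M_{i-1,t}>0$ and $M_{i,t}>0$, then $R_{i-1}\prec R_t$ and $R_i\prec R_t$; (2) if $M_{i-1,t}>0$ and $M_{i,t}=0$, then $R_t\prec R_{i-1}$; (3) if $M_{i-1,t}=0$ and $M_{i,t}>0$, then $R_t\prec R_i$; (4) if $R_t\prec R_{i-1}$, then $M_{i,t}=0$, $M_{a,t}=0$ for all $a\in A$, and $R_t\prec R_b$ for all $b\in B$; (5) if $R_t\prec R_i$, then $M_{i-1,t}=0$, $M_{a,t}=0$ for all $a\in A$, and $R_t\prec R_b$ for all $b\in B$. Then $A\cup B\cup C=\{1,\dots,n\}$.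
   Context: A row is $R=a/b=\{(1,j):b+1\le j\le a\}$ ($a\ge b\ge0$ integers); $l(R)=b$, $r(R)=a-1$, $|R|$ its number of cells, $R^+=(a+1)/(b+1)$. For rows $R,R'$: $M(R,R')=|R\cap R'|$ if $l(R)\le l(R')$, else $|R\cap R'^+|$. For a horizontal-strip (sequence of rows) $(R_1,\dots,R_n)$, $M_{i,j}=M(R_{\min(i,j)},R_{\max(i,j)})$ for $i\ne j$, and $R_i\prec R_j$ means $M_{i,j}=|R_i|$. -}

module Defs where

open import Data.Nat using (ℕ; suc; _≤_; _∸_; _⊓_; _⊔_; _≤ᵇ_)
open import Data.Bool using (if_then_else_)
open import Data.Fin using (Fin; toℕ)
open import Relation.Binary.PropositionalEquality using (_≡_)

-- A row a/b = {(1,j) : b+1 ≤ j ≤ a}, with a ≥ b ≥ 0.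
record Row : Set where
  constructor _/_[_]
  field
    a   : ℕ
    b   : ℕ
    b≤a : b ≤ a
open Row public

l : Row → ℕ
l R = b R

-- r(R) + 1 = a  (r(R) = a - 1; we only ever use r(R) + 1, avoiding truncated subtraction)
r+1 : Row → ℕ
r+1 R = a R

size : Row → ℕ
size R = a R ∸ b R

-- |R ∩ R'| : number of common cells of two rows (intersection of
-- the column intervals [b+1, a] and [b'+1, a']).
∣_∩_∣ : Row → Row → ℕ
∣ R ∩ R' ∣ = (a R ⊓ a R') ∸ (b R ⊔ b R')

_⁺ : Row → Row
(x / y [ p ]) ⁺ = suc x / suc y [ Data.Nat.s≤s p ]

Mrow : Row → Row → ℕ
Mrow R R' = if l R ≤ᵇ l R' then ∣ R ∩ R' ∣ else ∣ R ∩ (R' ⁺) ∣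

Strip : ℕ → Set
Strip n = Fin n → Row

-- M_{s,t} = M(R_min(s,t), R_max(s,t))  (used for s ≠ t)
M : ∀ {n} → Strip n → Fin n → Fin n → ℕ
M λ' s t = if toℕ s ≤ᵇ toℕ t then Mrow (λ' s) (λ' t) else Mrow (λ' t) (λ' s)

_⊢_≺_ : ∀ {n} → Strip n → Fin n → Fin n → Set
λ' ⊢ s ≺ t = M λ' s t ≡ size (λ' s)

{-# OPTIONS --safe #-}
-- Every t outside {i-1, i} falls into one of the four sign patterns of
-- (M_{i-1,t}, M_{i,t}): (0,0) puts t in A, (+,+) in B by (1), and the mixed
-- patterns in C_{i-1} resp. C_i by (2) with (4) resp. (3) with (5).
module Submission where

open import Defs
open import Data.Nat using (ℕ; zero; suc; _>_)
open import Data.Nat.Properties using (0<1+n)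
open import Data.Fin using (Fin; toℕ)
open import Data.Fin.Properties using (_≟_)
open import Data.Product using (_×_; _,_)
open import Data.Sum using (_⊎_; inj₁; inj₂)
open import Relation.Binary.PropositionalEquality using (_≡_; _≢_; refl)
open import Relation.Nullary using (yes; no)

zero⊎positive : (k : ℕ) → k ≡ 0 ⊎ k > 0
zero⊎positive zero    = inj₁ refl
zero⊎positive (suc k) = inj₂ 0<1+n

proposition5p40 : (n : ℕ) (R : Strip n) (p q : Fin n) →
    -- p = i-1, q = i (so 2 ≤ i ≤ n)
    toℕ q ≡ suc (toℕ p) →
    -- l(R_i) = r(R_{i-1}) + 1
    l (R q) ≡ r+1 (R p) →
    let
    I : Fin n → Set
    I t = (t ≢ p) × (t ≢ q)
    A : Fin n → Set
    A t = I t × (M R p t ≡ 0) × (M R q t ≡ 0)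
    B : Fin n → Set
    B t = I t × (R ⊢ p ≺ t) × (R ⊢ q ≺ t)
    AB : Fin n → Set
    AB t = (∀ x → A x → x ≢ t → M R x t ≡ 0) × (∀ y → B y → y ≢ t → R ⊢ t ≺ y)
    Cp : Fin n → Set
    Cp t = I t × (R ⊢ t ≺ p) × (M R q t ≡ 0) × AB t
    Cq : Fin n → Set
    Cq t = I t × (R ⊢ t ≺ q) × (M R p t ≡ 0) × AB t
    C : Fin n → Set
    C t = Cp t ⊎ Cq t ⊎ (t ≡ p) ⊎ (t ≡ q)
    in
    (∀ t → I t → M R p t > 0 → M R q t > 0 → (R ⊢ p ≺ t) × (R ⊢ q ≺ t)) →
    (∀ t → I t → M R p t > 0 → M R q t ≡ 0 → R ⊢ t ≺ p) →
    (∀ t → I t → M R p t ≡ 0 → M R q t > 0 → R ⊢ t ≺ q) →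
    (∀ t → I t → R ⊢ t ≺ p → (M R q t ≡ 0) × AB t) →
    (∀ t → I t → R ⊢ t ≺ q → (M R p t ≡ 0) × AB t) →
    ∀ t → A t ⊎ B t ⊎ C t
proposition5p40 n R p q _ _ both→B p-only→p q-only→q ≺p→C ≺q→C t
  with t ≟ p | t ≟ q
... | yes t≡p | _       = inj₂ (inj₂ (inj₂ (inj₂ (inj₁ t≡p))))
... | no _    | yes t≡q = inj₂ (inj₂ (inj₂ (inj₂ (inj₂ t≡q))))
... | no t≢p  | no t≢q
  with zero⊎positive (M R p t) | zero⊎positive (M R q t)
... | inj₁ Mpt≡0 | inj₁ Mqt≡0 = inj₁ (t∈I , Mpt≡0 , Mqt≡0)
  where t∈I = t≢p , t≢q
... | inj₂ Mpt>0 | inj₂ Mqt>0 = inj₂ (inj₁ (t∈I , both→B t t∈I Mpt>0 Mqt>0))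
  where t∈I = t≢p , t≢q
... | inj₂ Mpt>0 | inj₁ Mqt≡0 = inj₂ (inj₂ (inj₁ (t∈I , t≺p , ≺p→C t t∈I t≺p)))
  where t∈I = t≢p , t≢q
        t≺p = p-only→p t t∈I Mpt>0 Mqt≡0
... | inj₁ Mpt≡0 | inj₂ Mqt>0 = inj₂ (inj₂ (inj₂ (inj₁ (t∈I , t≺q , ≺q→C t t∈I t≺q))))
  where t∈I = t≢p , t≢q
        t≺q = q-only→q t t∈I Mpt≡0 Mqt>0
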